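{- Let $k\ge 2$, let $m_1,\ldots,m_k$ be nonnegative integers and $n\ge0$. Then \[\mathcal{D}_k(m_1,\ldots,m_k;n)=\sum_{t_1,\ldots,t_{k-1}=0}^{\infty}\mathcal{D}^{ss}_k(m_1+2t_1,\ldots,m_{k-1}+2t_{k-1},m_k;n).\]
   Context: A partition is a finite nonincreasing sequence of positive integers; $l(\lambda)$ is the number of parts, $|\lambda|$ the sum, $\lambda_1$ the largest part ($0$ if empty). For $k\geq 1$, a $k$-marked Durfee symbol of $n$ is an array $\eta=\begin{pmatrix}\alpha^k,&\ldots,&\alpha^1\\ \beta^k,&\ldots,&\beta^1\end{pmatrix}_D$ where $D\ge 0$ is an integer, each $\alpha^i,\beta^i$ is a (possibly empty) partition, $\sum_{i}(|\alpha^i|+|\beta^i|)+D^2=n$, and: (1) $\alpha^i$ is nonempty for $1\leq i<k$; (2) for $2\le i\le k$, $\beta^{i-1}_1\le \alpha^{i-1}_1$ and $\alpha^{i-1}_1$ is at most every part of $\alpha^i$ and of $\beta^i$; (3) every part of $\alpha^k$ and $\beta^k$ is at most $D$. Its $i$th rank is $l(\alpha^i)-l(\beta^i)-1$ for $1\le i<k$ and $l(\alpha^k)-l(\beta^k)$ for $i=k$. $\mathcal{D}_k(m_1,\ldots,m_k;n)$ is the number of $k$-marked Durfee symbols of $n$ with $i$th rank $m_i$ for all $i$. A pair $(\alpha,\beta)$ of partitions is strict shifted if $l(\alpha)>l(\beta)$ and $\alpha_{i+1}>\beta_i$ for $1\le i\le l(\beta)$. A $k$-marked Durfee symbol is strict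 shifted if $(\alpha^i,\beta^i)$ is strict shifted for every $1\le i<k$; $\mathcal{D}^{ss}_k(m_1,\ldots,m_k;n)$ is the number of these of $n$ with $i$th rank $m_i$ for all $i$. -}

module Defs where

open import Data.Bool using (Bool; true; false; _∧_; not; if_then_else_)
open import Data.Nat using (ℕ; zero; suc; _+_; _*_; _∸_; _≤ᵇ_; _<ᵇ_; _≡ᵇ_; pred)
open import Data.Fin using (Fin; toℕ)
open import Data.List using (List; []; _∷_; [_]; _++_; map; concatMap; upTo; allFin; length; filterᵇ; null)
open import Data.Bool.ListAction using (and)
open import Data.Nat.ListAction using (sum)
open import Data.Vec using (Vec; []; _∷_; lookup; toList)
open import Data.Integer using (ℤ; +_; _-_)
open import Data.Integer.Properties using () renaming (_≟_ to _≟ℤ_)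
open import Relation.Nullary.Decidable using (isYes)

all : ∀ {A : Set} → (A → Bool) → List A → Bool
all p xs = and (map p xs)

largest : List ℕ → ℕ
largest []      = 0
largest (x ∷ _) = x

nonincreasing : List ℕ → Bool
nonincreasing []           = true
nonincreasing (x ∷ [])     = true
nonincreasing (x ∷ y ∷ xs) = (y ≤ᵇ x) ∧ nonincreasing (y ∷ xs)

isPartition : List ℕ → Bool
isPartition xs = all (λ x → 1 ≤ᵇ x) xs ∧ nonincreasing xs

-- Raw k-marked arrays.  Index j : Fin k corresponds to the paper's i = j+1,
-- so alphas[j] = α^{j+1}, betas[j] = β^{j+1}.

record Sym (k : ℕ) : Set where
  constructor sym
  field
    D      : ℕ
    alphas : Vec (List ℕ) k
    betas  : Vec (List ℕ) k
open Sym public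

module _ {k : ℕ} (s : Sym k) where
  α : Fin k → List ℕ
  α j = lookup (alphas s) j
  β : Fin k → List ℕ
  β j = lookup (betas s) j

  weight : ℕ
  weight = sum (map (λ j → sum (α j) + sum (β j)) (allFin k)) + D s * D s

  partitionsOK : Bool
  partitionsOK = all (λ j → isPartition (α j) ∧ isPartition (β j)) (allFin k)

  cond1 : Bool
  cond1 = all (λ j → if suc (toℕ j) <ᵇ k then not (null (α j)) else true) (allFin k)

  -- (2) for 2 ≤ i ≤ k (i-1 = j, i = j'):  β^{i-1}_1 ≤ α^{i-1}_1  and
  --     α^{i-1}_1 ≤ every part of α^i and of β^i
  cond2 : Bool
  cond2 = all (λ j → all (λ j' →
            if toℕ j' ≡ᵇ suc (toℕ j)
            then (largest (β j) ≤ᵇ largest (α j))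
                 ∧ all (λ x → largest (α j) ≤ᵇ x) (α j' ++ β j')
            else true) (allFin k)) (allFin k)

  cond3 : Bool
  cond3 = all (λ j → if suc (toℕ j) ≡ᵇ k
                     then all (λ x → x ≤ᵇ D s) (α j ++ β j)
                     else true) (allFin k)

  isDurfee : ℕ → Bool
  isDurfee n = partitionsOK ∧ cond1 ∧ cond2 ∧ cond3 ∧ (weight ≡ᵇ n)

  rank : Fin k → ℤ
  rank j = if suc (toℕ j) <ᵇ k
           then (+ length (α j)) - (+ length (β j)) - + 1
           else (+ length (α j)) - (+ length (β j))

  hasRanks : Vec ℕ k → Bool
  hasRanks ms = all (λ j → isYes (rank j ≟ℤ + lookup ms j)) (allFin k)

-- strict shifted pair: l(α) > l(β) and α_{i+1} > β_i for 1 ≤ i ≤ l(β)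
shiftedParts : List ℕ → List ℕ → Bool
shiftedParts _        []       = true
shiftedParts []       (_ ∷ _)  = false
shiftedParts (a ∷ as) (b ∷ bs) = (b <ᵇ a) ∧ shiftedParts as bs

strictShifted : List ℕ → List ℕ → Bool
strictShifted a b = (length b <ᵇ length a) ∧ shiftedParts (Data.List.drop 1 a) b

isStrictShiftedSym : ∀ {k} → Sym k → Bool
isStrictShiftedSym {k} s =
  all (λ j → if suc (toℕ j) <ᵇ k then strictShifted (α s j) (β s j) else true) (allFin k)

listsOfLength : ℕ → List ℕ → List (List ℕ)
listsOfLength zero    vs = [ [] ]
listsOfLength (suc j) vs = concatMap (λ v → map (v ∷_) (listsOfLength j vs)) vs

vecsOf : ∀ {A : Set} (j : ℕ) → List A → List (Vec A j)
vecsOf zero    xs = [ [] ]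
vecsOf (suc j) xs = concatMap (λ x → map (x ∷_) (vecsOf j xs)) xs

oneTo : ℕ → List ℕ
oneTo n = map suc (upTo n)

-- every partition of size ≤ n occurs (exactly once) among these lists:
-- lists of length ≤ n with entries in [1..n]
smallLists : ℕ → List (List ℕ)
smallLists n = concatMap (λ j → listsOfLength j (oneTo n)) (upTo (suc n))

-- every k-marked Durfee symbol of n occurs exactly once among these
candidates : (k n : ℕ) → List (Sym k)
candidates k n =
  concatMap (λ d → concatMap (λ as → map (λ bs → sym d as bs)
                      (vecsOf k (smallLists n)))
                   (vecsOf k (smallLists n)))
            (upTo (suc n))

𝒟 : (k : ℕ) → Vec ℕ k → ℕ → ℕ
𝒟 k ms n = length (filterᵇ (λ s → isDurfee s n ∧ hasRanks s ms) (candidates k n))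

𝒟ss : (k : ℕ) → Vec ℕ k → ℕ → ℕ
𝒟ss k ms n = length (filterᵇ (λ s → isDurfee s n ∧ isStrictShiftedSym s ∧ hasRanks s ms)
                             (candidates k n))

addShift : ∀ {k} → Vec ℕ k → Vec ℕ (pred k) → Vec ℕ k
addShift []            []       = []
addShift (m ∷ [])      []       = m ∷ []
addShift (m ∷ m' ∷ ms) (t ∷ ts) = (m + 2 * t) ∷ addShift (m' ∷ ms) ts

-- partial sum of the right-hand side over 0 ≤ t_1,…,t_{k-1} ≤ N
partialSum : (k : ℕ) → Vec ℕ k → ℕ → ℕ → ℕ
partialSum k ms n N = sum (map (λ t → 𝒟ss k (addShift ms t) n) (vecsOf (pred k) (upTo (suc N))))

module Submission where

-- The proof is a bijection on one inner level (α , β) = (a ∷ u , v).  If the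
-- pair is not strict shifted, let j be the first index with u_j ≤ v_j (or
-- where u runs out).  "Raising" exchanges the tails:
--   (u₁…u_{j-1} u_j u_{j+1}… , v₁…v_j v_{j+1}…) ↦ (v₁…v_j u_j u_{j+1}… , u₁…u_{j-1} v_{j+1}…).
-- It keeps both sequences partitions, keeps a and the multiset of parts, adds 2
-- to the rank, and is undone by the reverse exchange ("lowering").  Raising
-- until the pair is strict shifted sends a pair of rank m to a strict shifted
-- pair of rank m + 2t together with t, bijectively.  The Durfee conditions and
-- the weight only see what raising preserves, so doing this at every inner
-- level matches symbols of n with ranks m and pairs (t , strict shifted symbol
-- of n with ranks m + 2t); as t_i ≤ n, partial sums stabilise from N = n + 1.
-- Sections: counting lists; partitions; the exchange; raising and lowering;
-- reduction by iterated raising; symbols and ranks; enumeration; the bijection.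

open import Defs
open import Data.Bool using (Bool; true; false; _∧_; not; if_then_else_; T)
open import Data.Bool.Properties using (∧-assoc; ∧-comm; ∧-zeroʳ; T?; T-≡)
open import Data.Empty using (⊥; ⊥-elim)
open import Data.Fin using (Fin; toℕ; fromℕ<) renaming (zero to fzero; suc to fsuc)
open import Data.Fin.Properties using (toℕ-fromℕ<)
open import Data.Integer using (ℤ; +_; -_; _-_; _⊖_)
open import Data.Integer.Properties using ([+m]-[+n]≡m⊖n; distribˡ-⊖-+-neg; [1+m]⊖[1+n]≡m⊖n; +-cancelˡ-⊖; ⊖-≥; ⊖-<)
  renaming (_≟_ to _≟ℤ_; +-injective to ℤ+-injective)
open import Data.List using (List; []; _∷_; _++_; map; length; null; concatMap; filterᵇ; allFin; upTo)
open import Data.List.Properties using (map-cong; length-++; length-map; map-∘; map-id-local; ∷-injectiveˡ; ∷-injectiveʳ)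
open import Data.List.Membership.Propositional using (_∈_; find; lose)
open import Data.List.Membership.Propositional.Properties
  using (∈-map⁺; ∈-map⁻; ∈-filter⁺; ∈-filter⁻; ∈-allFin; ∈-concatMap⁺; ∈-concatMap⁻; ∈-upTo⁺)
open import Data.List.Membership.Propositional.Properties.WithK using (unique∧set⇒bag)
open import Data.List.Relation.Binary.BagAndSetEquality using (∼bag⇒↭)
open import Data.List.Relation.Binary.Permutation.Propositional as ↭ using (_↭_; ↭-prep; ↭-trans; ↭-sym)
open import Data.List.Relation.Binary.Permutation.Propositional.Properties using (shift; ++-comm; ∷↭∷ʳ; ↭-length)
import Data.List.Relation.Unary.All as All
open import Data.List.Relation.Unary.Any using (here; there)
open import Data.List.Relation.Unary.Unique.Propositional using (Unique; []; _∷_)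
import Data.List.Relation.Unary.Unique.Propositional.Properties as Unique
open import Data.Nat using (ℕ; zero; suc; _+_; _*_; _∸_; _≤_; _<_; _≤ᵇ_; _<ᵇ_; _≡ᵇ_; z≤n; s≤s; pred)
open import Data.Nat.ListAction using (sum)
open import Data.Nat.ListAction.Properties using (sum-↭; sum-++)
open import Data.Nat.Properties
open import Data.Nat.Tactic.RingSolver using (solve-∀)
open import Data.Product using (∃-syntax; _×_; _,_; proj₁; proj₂; map₁)
open import Data.Unit using (⊤; tt)
open import Data.Vec using (Vec; []; _∷_; lookup)
import Data.Vec.Properties as Vec
open import Function using (_∘_)
open import Function.Bundles using (mk⇔; Equivalence)
open import Relation.Binary.PropositionalEquality
  using (_≡_; _≢_; refl; cong; cong₂; subst; subst₂; trans; module ≡-Reasoning) renaming (sym to ≡-sym)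
open import Relation.Nullary using (yes; no)
open import Relation.Nullary.Decidable using (isYes; toWitness; fromWitness)

-- Counting finite lists

length-bijection : ∀ {a b} {A : Set a} {B : Set b} (f : A → B) (g : B → A) (xs : List A) (ys : List B) →
  Unique xs → Unique ys →
  (∀ {x} → x ∈ xs → f x ∈ ys) → (∀ {y} → y ∈ ys → g y ∈ xs) →
  (∀ {x} → x ∈ xs → g (f x) ≡ x) → (∀ {y} → y ∈ ys → f (g y) ≡ y) →
  length xs ≡ length ys
length-bijection f g xs ys uxs uys f∈ g∈ gf fg =
  trans (≡-sym (length-map f xs)) (↭-length (∼bag⇒↭ (unique∧set⇒bag uniq-fxs uys (mk⇔ to from))))
  where
    g∘f-on-xs : map g (map f xs) ≡ xs
    g∘f-on-xs = trans (≡-sym (map-∘ xs)) (map-id-local (All.tabulate gf))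
    uniq-fxs : Unique (map f xs)
    uniq-fxs = Unique.map⁻ (subst Unique (≡-sym g∘f-on-xs) uxs)
    to : ∀ {y} → y ∈ map f xs → y ∈ ys
    to y∈ with ∈-map⁻ f y∈
    ... | x , x∈ , refl = f∈ x∈
    from : ∀ {y} → y ∈ ys → y ∈ map f xs
    from y∈ = subst (_∈ map f xs) (fg y∈) (∈-map⁺ f (g∈ y∈))

module _ {A B : Set} (f : A → List B) where

  ∈-concatMap-intro : ∀ {xs x y} → x ∈ xs → y ∈ f x → y ∈ concatMap f xs
  ∈-concatMap-intro x∈ y∈ = ∈-concatMap⁺ f (lose x∈ y∈)

  ∈-concatMap-elim : ∀ xs {y} → y ∈ concatMap f xs → ∃[ x ] (x ∈ xs × y ∈ f x)
  ∈-concatMap-elim xs y∈ = find (∈-concatMap⁻ f y∈)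

  concatMap-unique : ∀ {xs} → Unique xs → (∀ x → Unique (f x)) →
    (∀ {x x' z} → z ∈ f x → z ∈ f x' → x ≡ x') → Unique (concatMap f xs)
  concatMap-unique [] uf block = []
  concatMap-unique {x ∷ xs} (x∉ ∷ uxs) uf block =
    Unique.++⁺ (uf x) (concatMap-unique uxs uf block) disjoint
    where
      disjoint : ∀ {z} → z ∈ f x × z ∈ concatMap f xs → ⊥
      disjoint (z∈fx , z∈rest) with ∈-concatMap-elim xs z∈rest
      ... | x' , x'∈ , z∈fx' = All.lookup x∉ x'∈ (block z∈fx z∈fx')

-- The list of all pairs (t , s) with t from T and s from L t.  Its length is
-- the sum over t of the lengths of L t; this realises the sum in partialSum.
module _ {A B : Set} where

  tagged : List A → (A → List B) → List (A × B)
  tagged T L = concatMap (λ t → map (t ,_) (L t)) T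

  length-tagged : ∀ T L → length (tagged T L) ≡ sum (map (λ t → length (L t)) T)
  length-tagged [] L = refl
  length-tagged (t ∷ T) L = trans (length-++ (map (t ,_) (L t)))
    (cong₂ _+_ (length-map (t ,_) (L t)) (length-tagged T L))

  ∈-tagged⁺ : ∀ {T L t s} → t ∈ T → s ∈ L t → (t , s) ∈ tagged T L
  ∈-tagged⁺ {L = L} {t} t∈ s∈ = ∈-concatMap-intro (λ t → map (t ,_) (L t)) t∈ (∈-map⁺ (t ,_) s∈)

  ∈-tagged⁻ : ∀ {T L t s} → (t , s) ∈ tagged T L → t ∈ T × s ∈ L t
  ∈-tagged⁻ {T} {L} ts∈ with ∈-concatMap-elim (λ t → map (t ,_) (L t)) T ts∈
  ... | t , t∈ , ts∈' with ∈-map⁻ (t ,_) ts∈'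
  ...   | _ , s∈ , refl = t∈ , s∈

  tagged-unique : ∀ T L → Unique T → (∀ t → Unique (L t)) → Unique (tagged T L)
  tagged-unique T L uT uL = concatMap-unique (λ t → map (t ,_) (L t)) uT
    (λ t → Unique.map⁺ (cong proj₂) (uL t)) same-tag
    where
      same-tag : ∀ {t t' z} → z ∈ map (t ,_) (L t) → z ∈ map (t' ,_) (L t') → t ≡ t'
      same-tag {t} {t'} z∈ z∈' with ∈-map⁻ (t ,_) z∈ | ∈-map⁻ (t' ,_) z∈'
      ... | _ , _ , refl | _ , _ , eq = cong proj₁ eq

T⇒≡true : ∀ {b} → T b → b ≡ true
T⇒≡true = Equivalence.to T-≡

≡true⇒T : ∀ {b} → b ≡ true → T b
≡true⇒T = Equivalence.from T-≡

∧-true : ∀ {x y} → x ∧ y ≡ true → x ≡ true × y ≡ true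
∧-true {true} {true} _ = refl , refl

not-false : ∀ {b} → not b ≡ false → b ≡ true
not-false {true} _ = refl

not-true : ∀ {b} → not b ≡ true → b ≡ false
not-true {false} _ = refl

if-true : ∀ {A : Set} {b} {x y : A} → b ≡ true → (if b then x else y) ≡ x
if-true refl = refl

if-false : ∀ {A : Set} {b} {x y : A} → b ≡ false → (if b then x else y) ≡ y
if-false refl = refl

≤ᵇ-true : ∀ {m n} → m ≤ n → (m ≤ᵇ n) ≡ true
≤ᵇ-true m≤n = T⇒≡true (≤⇒≤ᵇ m≤n)

≤ᵇ-true⁻ : ∀ m n → (m ≤ᵇ n) ≡ true → m ≤ n
≤ᵇ-true⁻ m n e = ≤ᵇ⇒≤ m n (≡true⇒T e)

≤ᵇ-false⁻ : ∀ m n → (m ≤ᵇ n) ≡ false → n < m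
≤ᵇ-false⁻ m n e = ≰⇒> (λ m≤n → true≢false (trans (≡-sym (≤ᵇ-true m≤n)) e))
  where true≢false : true ≢ false
        true≢false ()

<ᵇ-not-≤ᵇ : ∀ x y → (y <ᵇ x) ≡ not (x ≤ᵇ y)
<ᵇ-not-≤ᵇ zero y = refl
<ᵇ-not-≤ᵇ (suc zero) zero = refl
<ᵇ-not-≤ᵇ (suc zero) (suc y) = refl
<ᵇ-not-≤ᵇ (suc (suc x)) zero = refl
<ᵇ-not-≤ᵇ (suc (suc x)) (suc y) = <ᵇ-not-≤ᵇ (suc x) y

module _ {A : Set} where

  all-cong : ∀ {f g : A → Bool} (xs : List A) → (∀ x → f x ≡ g x) → all f xs ≡ all g xs
  all-cong [] f≗g = refl
  all-cong (x ∷ xs) f≗g = cong₂ _∧_ (f≗g x) (all-cong xs f≗g)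

  all-∈ : ∀ {f : A → Bool} {xs x} → all f xs ≡ true → x ∈ xs → f x ≡ true
  all-∈ e (here refl) = proj₁ (∧-true e)
  all-∈ {f} {y ∷ _} e (there x∈) = all-∈ {f} (proj₂ (∧-true {f y} e)) x∈

  all-intro : ∀ {f : A → Bool} (xs : List A) → (∀ x → f x ≡ true) → all f xs ≡ true
  all-intro [] h = refl
  all-intro (x ∷ xs) h = cong₂ _∧_ (h x) (all-intro xs h)

  all-++ : ∀ (f : A → Bool) xs ys → all f (xs ++ ys) ≡ all f xs ∧ all f ys
  all-++ f [] ys = refl
  all-++ f (x ∷ xs) ys = trans (cong (f x ∧_) (all-++ f xs ys)) (≡-sym (∧-assoc (f x) (all f xs) (all f ys)))

  all-↭ : ∀ (f : A → Bool) {xs ys} → xs ↭ ys → all f xs ≡ all f ys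
  all-↭ f ↭.refl = refl
  all-↭ f (↭.prep x p) = cong (f x ∧_) (all-↭ f p)
  all-↭ f {x ∷ y ∷ xs} {_ ∷ _ ∷ ys} (↭.swap _ _ p) = begin
    f x ∧ (f y ∧ all f xs)  ≡⟨ ≡-sym (∧-assoc (f x) (f y) _) ⟩
    (f x ∧ f y) ∧ all f xs  ≡⟨ cong₂ _∧_ (∧-comm (f x) (f y)) (all-↭ f p) ⟩
    (f y ∧ f x) ∧ all f ys  ≡⟨ ∧-assoc (f y) (f x) _ ⟩
    f y ∧ (f x ∧ all f ys)  ∎
    where open ≡-Reasoning
  all-↭ f (↭.trans p q) = trans (all-↭ f p) (all-↭ f q)

allFin-at : ∀ {k} {f : Fin k → Bool} → all f (allFin k) ≡ true → ∀ j → f j ≡ true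
allFin-at {f = f} e j = all-∈ {f = f} e (∈-allFin j)

Nonincreasing : List ℕ → Set
Nonincreasing [] = ⊤
Nonincreasing (x ∷ xs) = largest xs ≤ x × Nonincreasing xs

nonincreasing-intro : ∀ xs → Nonincreasing xs → nonincreasing xs ≡ true
nonincreasing-intro [] _ = refl
nonincreasing-intro (x ∷ []) _ = refl
nonincreasing-intro (x ∷ y ∷ xs) (y≤x , ni) = cong₂ _∧_ (≤ᵇ-true y≤x) (nonincreasing-intro (y ∷ xs) ni)

nonincreasing-elim : ∀ xs → nonincreasing xs ≡ true → Nonincreasing xs
nonincreasing-elim [] _ = tt
nonincreasing-elim (x ∷ []) _ = z≤n , tt
nonincreasing-elim (x ∷ y ∷ xs) e =
  ≤ᵇ-true⁻ y x (proj₁ (∧-true e)) , nonincreasing-elim (y ∷ xs) (proj₂ (∧-true e))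

positive : ℕ → Bool
positive x = 1 ≤ᵇ x

isPartition-elim : ∀ xs → isPartition xs ≡ true → all positive xs ≡ true × Nonincreasing xs
isPartition-elim xs e = proj₁ (∧-true e) , nonincreasing-elim xs (proj₂ (∧-true e))

isPartition-intro : ∀ xs → all positive xs ≡ true → Nonincreasing xs → isPartition xs ≡ true
isPartition-intro xs pos ni = cong₂ _∧_ pos (nonincreasing-intro xs ni)

positive-↭ : ∀ {xs ys xs' ys'} → xs ++ ys ↭ xs' ++ ys' →
  all positive xs ≡ true → all positive ys ≡ true →
  all positive xs' ≡ true × all positive ys' ≡ true
positive-↭ {xs} {ys} {xs'} {ys'} p pxs pys = ∧-true (begin
  all positive xs' ∧ all positive ys'  ≡⟨ ≡-sym (all-++ positive xs' ys') ⟩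
  all positive (xs' ++ ys')           ≡⟨ ≡-sym (all-↭ positive p) ⟩
  all positive (xs ++ ys)             ≡⟨ all-++ positive xs ys ⟩
  all positive xs ∧ all positive ys   ≡⟨ cong₂ _∧_ pxs pys ⟩
  true                                ∎)
  where open ≡-Reasoning

-- A list of positive parts is no longer than its sum; this bounds all the
-- lengths (hence ranks and shifts) by n.
length≤sum : ∀ xs → all positive xs ≡ true → length xs ≤ sum xs
length≤sum [] _ = z≤n
length≤sum (x ∷ xs) e = +-mono-≤ (≤ᵇ-true⁻ 1 x (proj₁ (∧-true e))) (length≤sum xs (proj₂ (∧-true e)))

-- The exchange of tails at the first crossing

Pair : Set
Pair = List ℕ × List ℕ

-- `crossing u v` holds when some u_j ≤ v_j, or v is longer than u: exactly
-- when (a ∷ u , v) fails to be strict shifted (see `strictShifted-crossing`).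
crossing : List ℕ → List ℕ → Bool
crossing u [] = false
crossing [] (y ∷ v) = true
crossing (x ∷ u) (y ∷ v) = if x ≤ᵇ y then true else crossing u v

-- At the first crossing j, (u , v) ↦ (u₁…u_{j-1} v_{j+1}… , v₁…v_j u_j u_{j+1}…).
exchange : List ℕ → List ℕ → Pair
exchange u [] = u , []
exchange [] (y ∷ v) = v , y ∷ []
exchange (x ∷ u) (y ∷ v) =
  if x ≤ᵇ y then (v , y ∷ x ∷ u)
  else (x ∷ proj₁ (exchange u v) , y ∷ proj₂ (exchange u v))

strictShifted-crossing : ∀ a u v → strictShifted (a ∷ u) v ≡ not (crossing u v)
strictShifted-crossing a u [] = refl
strictShifted-crossing a [] (y ∷ v) = refl
strictShifted-crossing a (x ∷ u) (y ∷ v) rewrite <ᵇ-not-≤ᵇ x y with x ≤ᵇ y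
... | true = ∧-zeroʳ (length v <ᵇ suc (length u))
... | false = strictShifted-crossing a u v

exchange-↭ : ∀ u v → u ++ v ↭ proj₁ (exchange u v) ++ proj₂ (exchange u v)
exchange-↭ [] [] = ↭.refl
exchange-↭ (x ∷ u) [] = ↭.refl
exchange-↭ [] (y ∷ v) = ∷↭∷ʳ y v
exchange-↭ (x ∷ u) (y ∷ v) with x ≤ᵇ y
... | true = ↭-trans (++-comm (x ∷ u) (y ∷ v)) (↭-sym (shift y v (x ∷ u)))
... | false = ↭-prep x (↭-trans (shift y u v) (↭-trans (↭-prep y (exchange-↭ u v))
                (↭-sym (shift y (proj₁ (exchange u v)) (proj₂ (exchange u v))))))

-- The second component starts like v, and the first stays below any common
-- bound of u and v; with the next lemma this keeps β₁ ≤ α₁ and α's order.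
largest-exchange₂ : ∀ u v → largest (proj₂ (exchange u v)) ≡ largest v
largest-exchange₂ [] [] = refl
largest-exchange₂ (x ∷ u) [] = refl
largest-exchange₂ [] (y ∷ v) = refl
largest-exchange₂ (x ∷ u) (y ∷ v) with x ≤ᵇ y
... | true = refl
... | false = refl

largest-exchange₁ : ∀ c u v → Nonincreasing v → largest u ≤ c → largest v ≤ c →
  largest (proj₁ (exchange u v)) ≤ c
largest-exchange₁ c [] [] _ u≤c v≤c = u≤c
largest-exchange₁ c (x ∷ u) [] _ u≤c v≤c = u≤c
largest-exchange₁ c [] (y ∷ v) (v≤y , _) u≤c y≤c = ≤-trans v≤y y≤c
largest-exchange₁ c (x ∷ u) (y ∷ v) (v≤y , _) x≤c y≤c with x ≤ᵇ y
... | true = ≤-trans v≤y y≤c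
... | false = x≤c

exchange-nonincreasing : ∀ u v → Nonincreasing u → Nonincreasing v →
  Nonincreasing (proj₁ (exchange u v)) × Nonincreasing (proj₂ (exchange u v))
exchange-nonincreasing [] [] nu nv = tt , tt
exchange-nonincreasing (x ∷ u) [] nu nv = nu , tt
exchange-nonincreasing [] (y ∷ v) nu (_ , nv) = nv , (z≤n , tt)
exchange-nonincreasing (x ∷ u) (y ∷ v) (u≤x , nu) (v≤y , nv) with x ≤ᵇ y in x≤ᵇy
... | true = nv , (≤ᵇ-true⁻ x y x≤ᵇy , (u≤x , nu))
... | false =
  (largest-exchange₁ x u v nv u≤x (≤-trans v≤y (<⇒≤ (≤ᵇ-false⁻ x y x≤ᵇy))) , proj₁ rest) ,
  (subst (_≤ y) (≡-sym (largest-exchange₂ u v)) v≤y , proj₂ rest)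
  where rest = exchange-nonincreasing u v nu nv

exchange-length : ∀ u v → crossing u v ≡ true →
  suc (length (proj₁ (exchange u v))) ≡ length v × length (proj₂ (exchange u v)) ≡ suc (length u)
exchange-length (x ∷ u) (y ∷ v) c with x ≤ᵇ y
... | true = refl , refl
... | false = cong suc (proj₁ (exchange-length u v c)) , cong suc (proj₂ (exchange-length u v c))
exchange-length [] (y ∷ v) _ = refl , refl

longer-crossing : ∀ u v → length u < length v → crossing u v ≡ true
longer-crossing [] (y ∷ v) _ = refl
longer-crossing (x ∷ u) (y ∷ v) (s≤s l) with x ≤ᵇ y
... | true = refl
... | false = longer-crossing u v l

crossing-at-head : ∀ v y w → largest v ≤ y → crossing v (y ∷ w) ≡ true
crossing-at-head [] y w _ = refl
crossing-at-head (z ∷ v) y w z≤y rewrite ≤ᵇ-true z≤y = refl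

exchange-crossing : ∀ u v → Nonincreasing v → crossing u v ≡ true →
  crossing (proj₁ (exchange u v)) (proj₂ (exchange u v)) ≡ true
exchange-crossing [] (y ∷ v) (v≤y , _) _ = crossing-at-head v y [] v≤y
exchange-crossing (x ∷ u) (y ∷ v) (v≤y , nv) c with x ≤ᵇ y in x≤ᵇy
... | true = crossing-at-head v y (x ∷ u) v≤y
... | false rewrite x≤ᵇy = exchange-crossing u v nv c

exchange-involutive : ∀ u v → Nonincreasing v → crossing u v ≡ true →
  exchange (proj₁ (exchange u v)) (proj₂ (exchange u v)) ≡ (u , v)
exchange-involutive [] (y ∷ []) _ _ = refl
exchange-involutive [] (y ∷ z ∷ v) (z≤y , _) _ rewrite ≤ᵇ-true z≤y = refl
exchange-involutive (x ∷ u) (y ∷ v) (v≤y , nv) c with x ≤ᵇ y in x≤ᵇy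
exchange-involutive (x ∷ u) (y ∷ []) _ _ | true = refl
exchange-involutive (x ∷ u) (y ∷ z ∷ v) (z≤y , _) _ | true rewrite ≤ᵇ-true z≤y = refl
... | false rewrite x≤ᵇy | exchange-involutive u v nv c = refl

-- Raising and lowering one level (α , β)

-- The pairs occurring at an inner level of a Durfee symbol: α nonempty,
-- both partitions, and β₁ ≤ α₁.  Written out for α = a ∷ u and β = v.
data Admissible : Pair → Set where
  admissible : ∀ {a u v} → positive a ≡ true → all positive u ≡ true → all positive v ≡ true →
    Nonincreasing u → Nonincreasing v → largest u ≤ a → largest v ≤ a → Admissible (a ∷ u , v)

admissible-intro : ∀ α β → null α ≡ false → isPartition α ≡ true → isPartition β ≡ true →
  largest β ≤ largest α → Admissible (α , β)
admissible-intro (a ∷ u) v _ pα pβ v≤a with isPartition-elim (a ∷ u) pα | isPartition-elim v pβ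
... | pos-au , (u≤a , nu) | pv , nv =
  admissible (proj₁ (∧-true pos-au)) (proj₂ (∧-true pos-au)) pv nu nv u≤a v≤a

admissible-partitions : ∀ {α β} → Admissible (α , β) → isPartition α ≡ true × isPartition β ≡ true
admissible-partitions (admissible {a} {u} {v} pa pu pv nu nv u≤a v≤a) =
  isPartition-intro (a ∷ u) (cong₂ _∧_ pa pu) (u≤a , nu) , isPartition-intro v pv nv

-- α = a ∷ u and β = v have rank l(α) - l(β) - 1 = m.
HasRank : Pair → ℕ → Set
HasRank ([] , v) m = ⊥
HasRank (a ∷ u , v) m = length u ≡ length v + m

strictShiftedPair : Pair → Bool
strictShiftedPair (α , β) = strictShifted α β

raise : Pair → Pair
raise ([] , v) = [] , v
raise (a ∷ u , v) = a ∷ proj₂ (exchange u v) , proj₁ (exchange u v)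

lower : Pair → Pair
lower ([] , y) = [] , y
lower (a ∷ x , y) = a ∷ proj₁ (exchange y x) , proj₂ (exchange y x)

-- Everything the Durfee conditions and the weight can see of one level:
-- emptiness and first part of α, whether β₁ ≤ α₁, the multiset of all parts
-- (through boolean tests and the sum), and being partitions.
record SameContent (p q : Pair) : Set where
  field
    same-null : null (proj₁ p) ≡ null (proj₁ q)
    same-largest : largest (proj₁ p) ≡ largest (proj₁ q)
    same-bounded : (largest (proj₂ p) ≤ᵇ largest (proj₁ p)) ≡ (largest (proj₂ q) ≤ᵇ largest (proj₁ q))
    same-all : ∀ (f : ℕ → Bool) → all f (proj₁ p ++ proj₂ p) ≡ all f (proj₁ q ++ proj₂ q)
    same-sum : sum (proj₁ p) + sum (proj₂ p) ≡ sum (proj₁ q) + sum (proj₂ q)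
    same-partitions : isPartition (proj₁ p) ∧ isPartition (proj₂ p) ≡ isPartition (proj₁ q) ∧ isPartition (proj₂ q)
open SameContent public

sameContent-refl : ∀ {p} → SameContent p p
sameContent-refl = record { same-null = refl ; same-largest = refl ; same-bounded = refl
  ; same-all = λ f → refl ; same-sum = refl ; same-partitions = refl }

sameContent-trans : ∀ {p q r} → SameContent p q → SameContent q r → SameContent p r
sameContent-trans s t = record
  { same-null = trans (same-null s) (same-null t)
  ; same-largest = trans (same-largest s) (same-largest t)
  ; same-bounded = trans (same-bounded s) (same-bounded t)
  ; same-all = λ f → trans (same-all s f) (same-all t f)
  ; same-sum = trans (same-sum s) (same-sum t)
  ; same-partitions = trans (same-partitions s) (same-partitions t) }

sameContent-↭ : ∀ {a u v u' v'} → Admissible (a ∷ u , v) → Admissible (a ∷ u' , v') →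
  a ∷ u ++ v ↭ a ∷ u' ++ v' → SameContent (a ∷ u , v) (a ∷ u' , v')
sameContent-↭ {a} {u} {v} {u'} {v'} adm@(admissible _ _ _ _ _ _ v≤a) adm'@(admissible _ _ _ _ _ _ v'≤a) perm = record
  { same-null = refl
  ; same-largest = refl
  ; same-bounded = trans (≤ᵇ-true v≤a) (≡-sym (≤ᵇ-true v'≤a))
  ; same-all = λ f → all-↭ f perm
  ; same-sum = trans (≡-sym (sum-++ (a ∷ u) v)) (trans (sum-↭ perm) (sum-++ (a ∷ u') v'))
  ; same-partitions = trans (cong₂ _∧_ (proj₁ pp) (proj₂ pp)) (≡-sym (cong₂ _∧_ (proj₁ pp') (proj₂ pp'))) }
  where
    pp = admissible-partitions adm
    pp' = admissible-partitions adm'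

exchange-positive : ∀ u v → all positive u ≡ true → all positive v ≡ true →
  all positive (proj₁ (exchange u v)) ≡ true × all positive (proj₂ (exchange u v)) ≡ true
exchange-positive u v = positive-↭ {u} {v} {proj₁ (exchange u v)} {proj₂ (exchange u v)} (exchange-↭ u v)

raise-admissible : ∀ {p} → Admissible p → Admissible (raise p)
raise-admissible (admissible {a} {u} {v} pa pu pv nu nv u≤a v≤a) =
  admissible pa (proj₂ pos) (proj₁ pos) (proj₂ ni) (proj₁ ni)
    (subst (_≤ a) (≡-sym (largest-exchange₂ u v)) v≤a) (largest-exchange₁ a u v nv u≤a v≤a)
  where
    pos = exchange-positive u v pu pv
    ni = exchange-nonincreasing u v nu nv

lower-admissible : ∀ {p} → Admissible p → Admissible (lower p)
lower-admissible (admissible {a} {x} {y} pa px py nx ny x≤a y≤a) =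
  admissible pa (proj₁ pos) (proj₂ pos) (proj₁ ni) (proj₂ ni)
    (largest-exchange₁ a y x nx y≤a x≤a) (subst (_≤ a) (≡-sym (largest-exchange₂ y x)) x≤a)
  where
    pos = exchange-positive y x py px
    ni = exchange-nonincreasing y x ny nx

raise-sameContent : ∀ {p} → Admissible p → SameContent p (raise p)
raise-sameContent adm@(admissible {a} {u} {v} _ _ _ _ _ _ _) =
  sameContent-↭ adm (raise-admissible adm)
    (↭-prep a (↭-trans (exchange-↭ u v) (++-comm (proj₁ (exchange u v)) (proj₂ (exchange u v)))))

lower-sameContent : ∀ {p} → Admissible p → SameContent p (lower p)
lower-sameContent adm@(admissible {a} {x} {y} _ _ _ _ _ _ _) =
  sameContent-↭ adm (lower-admissible adm) (↭-prep a (↭-trans (++-comm x y) (exchange-↭ y x)))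

not-strictShifted-crossing : ∀ a u v → strictShiftedPair (a ∷ u , v) ≡ false → crossing u v ≡ true
not-strictShifted-crossing a u v ss = not-false (trans (≡-sym (strictShifted-crossing a u v)) ss)

rank+2 : ∀ l m → l + (m + 2) ≡ suc (suc l + m)
rank+2 = solve-∀

raise-rank : ∀ {p} m → Admissible p → strictShiftedPair p ≡ false → HasRank p m → HasRank (raise p) (m + 2)
raise-rank m (admissible {a} {u} {v} _ _ _ _ _ _ _) ss u≡v+m = begin
  length Q                     ≡⟨ proj₂ lens ⟩
  suc (length u)               ≡⟨ cong suc u≡v+m ⟩
  suc (length v + m)           ≡⟨ cong (λ l → suc (l + m)) (≡-sym (proj₁ lens)) ⟩
  suc (suc (length P) + m)     ≡⟨ ≡-sym (rank+2 (length P) m) ⟩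
  length P + (m + 2)           ∎
  where
    open ≡-Reasoning
    P = proj₁ (exchange u v)
    Q = proj₂ (exchange u v)
    lens = exchange-length u v (not-strictShifted-crossing a u v ss)

pairLength : Pair → ℕ
pairLength (α , β) = length α + length β

raise-pairLength : ∀ {p} → Admissible p → strictShiftedPair p ≡ false → pairLength (raise p) ≡ pairLength p
raise-pairLength (admissible {a} {u} {v} _ _ _ _ _ _ _) ss = cong suc (begin
  length Q + length P          ≡⟨ cong (_+ length P) (proj₂ lens) ⟩
  suc (length u + length P)    ≡⟨ ≡-sym (+-suc (length u) (length P)) ⟩
  length u + suc (length P)    ≡⟨ cong (λ l → length u + l) (proj₁ lens) ⟩
  length u + length v          ∎)
  where
    open ≡-Reasoning
    P = proj₁ (exchange u v)
    Q = proj₂ (exchange u v)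
    lens = exchange-length u v (not-strictShifted-crossing a u v ss)

lower-raise : ∀ {p} → Admissible p → strictShiftedPair p ≡ false → lower (raise p) ≡ p
lower-raise (admissible {a} {u} {v} _ _ _ _ nv _ _) ss
  rewrite exchange-involutive u v nv (not-strictShifted-crossing a u v ss) = refl

-- A pair of rank m + 2 always has crossing tails (β is too short), so
-- lowering it is the inverse of a raise and lowers the rank by 2.
rank+2-crossing : ∀ a x y m → HasRank (a ∷ x , y) (m + 2) → crossing y x ≡ true
rank+2-crossing a x y m x≡y+m+2 = longer-crossing y x (begin-strict
  length y               <⟨ s≤s (m≤m+n (length y) (suc m)) ⟩
  suc (length y + suc m) ≡⟨ ≡-sym (+-suc (length y) (suc m)) ⟩
  length y + suc (suc m) ≡⟨ cong (λ l → length y + l) (+-comm 2 m) ⟩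
  length y + (m + 2)     ≡⟨ ≡-sym x≡y+m+2 ⟩
  length x               ∎)
  where open ≤-Reasoning

lower-rank : ∀ {p} m → Admissible p → HasRank p (m + 2) → HasRank (lower p) m
lower-rank m (admissible {a} {x} {y} _ _ _ _ _ _ _) x≡y+m+2 = suc-injective (begin
  suc (length P)             ≡⟨ proj₁ lens ⟩
  length x                   ≡⟨ x≡y+m+2 ⟩
  length y + (m + 2)         ≡⟨ rank+2 (length y) m ⟩
  suc (suc (length y) + m)   ≡⟨ cong (λ l → suc (l + m)) (≡-sym (proj₂ lens)) ⟩
  suc (length Q + m)         ∎)
  where
    open ≡-Reasoning
    P = proj₁ (exchange y x)
    Q = proj₂ (exchange y x)
    lens = exchange-length y x (rank+2-crossing a x y m x≡y+m+2)

lower-not-strictShifted : ∀ {p} m → Admissible p → HasRank p (m + 2) → strictShiftedPair (lower p) ≡ false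
lower-not-strictShifted m (admissible {a} {x} {y} _ _ _ nx _ _ _) r =
  trans (strictShifted-crossing a (proj₁ (exchange y x)) (proj₂ (exchange y x)))
        (cong not (exchange-crossing y x nx (rank+2-crossing a x y m r)))

raise-lower : ∀ {p} m → Admissible p → HasRank p (m + 2) → raise (lower p) ≡ p
raise-lower m (admissible {a} {x} {y} _ _ _ nx _ _ _) r
  rewrite exchange-involutive y x nx (rank+2-crossing a x y m r) = refl

-- Reduction to a strict shifted pair

reduce : ℕ → Pair → ℕ × Pair
reduce zero p = 0 , p
reduce (suc f) p with strictShiftedPair p
... | true = 0 , p
... | false = map₁ suc (reduce f (raise p))

lower^ : ℕ → Pair → Pair
lower^ zero q = q
lower^ (suc t) q = lower (lower^ t q)

shift-step : ∀ m t → m + 2 + 2 * t ≡ m + 2 * suc t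
shift-step = solve-∀

reduce-bound : ∀ f p → proj₁ (reduce f p) ≤ f
reduce-bound zero p = z≤n
reduce-bound (suc f) p with strictShiftedPair p
... | true = z≤n
... | false = s≤s (reduce-bound f (raise p))

rank<pairLength : ∀ {p} m → Admissible p → HasRank p m → m < pairLength p
rank<pairLength m (admissible {u = u} {v} _ _ _ _ _ _ _) u≡v+m rewrite u≡v+m =
  s≤s (≤-trans (m≤n+m m (length v)) (m≤m+n (length v + m) (length v)))

record Reduction (p : Pair) (m t : ℕ) (q : Pair) : Set where
  field
    reduced-admissible : Admissible q
    reduced-rank : HasRank q (m + 2 * t)
    reduced-strict : strictShiftedPair q ≡ true
    reduced-content : SameContent p q
    reduced-lower : lower^ t q ≡ p
open Reduction public

-- Enough fuel: every raise keeps the number of parts and adds 2 to the rank,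
-- which stays below the number of parts.
reduce-correct : ∀ f {p} m → Admissible p → HasRank p m → pairLength p ≤ m + 2 * f →
  Reduction p m (proj₁ (reduce f p)) (proj₂ (reduce f p))
reduce-correct zero m adm r bound =
  ⊥-elim (<-irrefl refl (<-≤-trans (rank<pairLength m adm r) (≤-trans bound (≤-reflexive (+-identityʳ m)))))
reduce-correct (suc f) {p} m adm r bound with strictShiftedPair p in ss
... | true = record
  { reduced-admissible = adm ; reduced-rank = subst (HasRank p) (≡-sym (+-identityʳ m)) r
  ; reduced-strict = ss ; reduced-content = sameContent-refl ; reduced-lower = refl }
... | false = record
  { reduced-admissible = reduced-admissible next
  ; reduced-rank = subst (HasRank _) (shift-step m _) (reduced-rank next)
  ; reduced-strict = reduced-strict next
  ; reduced-content = sameContent-trans (raise-sameContent adm) (reduced-content next)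
  ; reduced-lower = trans (cong lower (reduced-lower next)) (lower-raise adm ss) }
  where
    bound' : pairLength (raise p) ≤ m + 2 + 2 * f
    bound' = subst₂ _≤_ (≡-sym (raise-pairLength adm ss)) (≡-sym (shift-step m f)) bound
    next = reduce-correct f (m + 2) (raise-admissible adm) (raise-rank m adm ss r) bound'

record Lowering (q : Pair) (m : ℕ) (p : Pair) : Set where
  field
    lowered-admissible : Admissible p
    lowered-rank : HasRank p m
    lowered-content : SameContent q p
open Lowering public

lower^-correct : ∀ t m {q} → Admissible q → HasRank q (m + 2 * t) → Lowering q m (lower^ t q)
lower^-correct zero m {q} adm r = record
  { lowered-admissible = adm ; lowered-rank = subst (HasRank q) (+-identityʳ m) r
  ; lowered-content = sameContent-refl }
lower^-correct (suc t) m {q} adm r = record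
  { lowered-admissible = lower-admissible (lowered-admissible prev)
  ; lowered-rank = lower-rank m (lowered-admissible prev) (lowered-rank prev)
  ; lowered-content = sameContent-trans (lowered-content prev) (lower-sameContent (lowered-admissible prev)) }
  where prev = lower^-correct t (m + 2) adm (subst (HasRank q) (≡-sym (shift-step m t)) r)

reduce-lower : ∀ f m {p} → Admissible p → HasRank p (m + 2) → reduce (suc f) (lower p) ≡ map₁ suc (reduce f p)
reduce-lower f m adm r rewrite lower-not-strictShifted m adm r | raise-lower m adm r = refl

reduce-lower^ : ∀ t f m {q} → Admissible q → strictShiftedPair q ≡ true → HasRank q (m + 2 * t) → t < f →
  reduce f (lower^ t q) ≡ (t , q)
reduce-lower^ zero (suc f) m adm ss r _ rewrite ss = refl
reduce-lower^ (suc t) (suc f) m {q} adm ss r (s≤s t<f) =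
  trans (reduce-lower f m (lowered-admissible prev) (lowered-rank prev))
        (cong (map₁ suc) (reduce-lower^ t f (m + 2) adm ss r' t<f))
  where
    r' = subst (HasRank q) (≡-sym (shift-step m t)) r
    prev = lower^-correct t (m + 2) adm r'

pairOf : ∀ {k} → Sym k → Fin k → Pair
pairOf s j = α s j , β s j

-- The inner levels i < k, where ranks carry the extra -1 and strict
-- shiftedness is required.
inner : ∀ {k} → Fin k → Bool
inner {k} j = suc (toℕ j) <ᵇ k

SameContentSym : ∀ {k} → Sym k → Sym k → Set
SameContentSym s s' = D s ≡ D s' × (∀ j → SameContent (pairOf s j) (pairOf s' j))

isDurfee-sameContent : ∀ {k} (s s' : Sym k) n → SameContentSym s s' → isDurfee s n ≡ isDurfee s' n
isDurfee-sameContent {k} s s' n (sameD , same) =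
  cong₂ _∧_ same-partitionsOK (cong₂ _∧_ same-cond1 (cong₂ _∧_ same-cond2 (cong₂ _∧_ same-cond3 same-weight)))
  where
    same-partitionsOK : partitionsOK s ≡ partitionsOK s'
    same-partitionsOK = all-cong (allFin k) (λ j → same-partitions (same j))
    same-cond1 : cond1 s ≡ cond1 s'
    same-cond1 = all-cong (allFin k) (λ j →
      cong (λ b → if suc (toℕ j) <ᵇ k then not b else true) (same-null (same j)))
    same-cond2 : cond2 s ≡ cond2 s'
    same-cond2 = all-cong (allFin k) (λ j → all-cong (allFin k) (λ j' →
      cong₂ (λ b c → if toℕ j' ≡ᵇ suc (toℕ j) then b ∧ c else true)
        (same-bounded (same j))
        (trans (same-all (same j') (λ x → largest (α s j) ≤ᵇ x))
               (cong (λ l → all (λ x → l ≤ᵇ x) (α s' j' ++ β s' j')) (same-largest (same j))))))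
    same-cond3 : cond3 s ≡ cond3 s'
    same-cond3 = all-cong (allFin k) (λ j → cong (λ b → if suc (toℕ j) ≡ᵇ k then b else true)
      (trans (same-all (same j) (λ x → x ≤ᵇ D s))
             (cong (λ d → all (λ x → x ≤ᵇ d) (α s' j ++ β s' j)) sameD)))
    same-weight : (weight s ≡ᵇ n) ≡ (weight s' ≡ᵇ n)
    same-weight = cong (_≡ᵇ n)
      (cong₂ _+_ (cong sum (map-cong (λ j → same-sum (same j)) (allFin k))) (cong₂ _*_ sameD sameD))

record DurfeeFacts {k} (s : Sym k) (n : ℕ) : Set where
  field
    level-partitions : ∀ j → isPartition (α s j) ≡ true × isPartition (β s j) ≡ true
    inner-nonempty : ∀ j → inner j ≡ true → null (α s j) ≡ false
    inner-bounded : ∀ j → inner j ≡ true → largest (β s j) ≤ largest (α s j)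
    level-size : ∀ j → sum (α s j) + sum (β s j) ≤ n
    durfee-size : D s ≤ n
open DurfeeFacts public

-- A summand is at most the sum; with D ≤ D² this bounds every part of the
-- weight of a symbol of n by n.
sum-map-∈ : ∀ {A : Set} (h : A → ℕ) {xs x} → x ∈ xs → h x ≤ sum (map h xs)
sum-map-∈ h {y ∷ ys} (here refl) = m≤m+n (h y) _
sum-map-∈ h {y ∷ ys} (there x∈) = ≤-trans (sum-map-∈ h x∈) (m≤n+m _ (h y))

m≤m*m : ∀ m → m ≤ m * m
m≤m*m zero = z≤n
m≤m*m (suc m) = m≤m*n (suc m) (suc m)

cond2-bounded : ∀ {k} (s : Sym k) → cond2 s ≡ true → ∀ j j' → toℕ j' ≡ suc (toℕ j) →
  largest (β s j) ≤ largest (α s j)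
cond2-bounded {k} s c2 j j' j'≡1+j =
  ≤ᵇ-true⁻ _ _ (proj₁ (∧-true (trans (≡-sym (if-true (T⇒≡true (≡⇒≡ᵇ _ _ j'≡1+j))))
                                     (allFin-at {f = link j} (allFin-at {f = λ j → all (link j) (allFin k)} c2 j) j'))))
  where
    link : Fin k → Fin k → Bool
    link j j' = if toℕ j' ≡ᵇ suc (toℕ j)
                then (largest (β s j) ≤ᵇ largest (α s j)) ∧ all (λ x → largest (α s j) ≤ᵇ x) (α s j' ++ β s j')
                else true

durfeeFacts : ∀ {k} (s : Sym k) n → isDurfee s n ≡ true → DurfeeFacts s n
durfeeFacts {k} s n e = record
  { level-partitions = λ j → ∧-true (allFin-at {f = λ j → isPartition (α s j) ∧ isPartition (β s j)} pOK j)
  ; inner-nonempty = λ j ie → not-true (trans (≡-sym (if-true ie))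
                       (allFin-at {f = λ j → if inner j then not (null (α s j)) else true} c1 j))
  ; inner-bounded = λ j ie → let j<k = <ᵇ⇒< _ _ (≡true⇒T ie) in
                      cond2-bounded s c2 j (fromℕ< j<k) (toℕ-fromℕ< j<k)
  ; level-size = λ j → ≤-trans (sum-map-∈ (λ j → sum (α s j) + sum (β s j)) (∈-allFin j))
                                 (≤-trans (m≤m+n _ _) (≤-reflexive weight≡n))
  ; durfee-size = ≤-trans (m≤m*m (D s)) (≤-trans (m≤n+m _ _) (≤-reflexive weight≡n)) }
  where
    e1 = ∧-true e
    e2 = ∧-true (proj₂ e1)
    e3 = ∧-true (proj₂ e2)
    e4 = ∧-true (proj₂ e3)
    pOK = proj₁ e1
    c1 = proj₁ e2
    c2 = proj₁ e3
    weight≡n : weight s ≡ n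
    weight≡n = ≡ᵇ⇒≡ _ _ (≡true⇒T (proj₂ e4))

level-admissible : ∀ {k} {s : Sym k} {n} → DurfeeFacts s n → ∀ j → inner j ≡ true → Admissible (pairOf s j)
level-admissible {s = s} facts j ie = admissible-intro (α s j) (β s j) (inner-nonempty facts j ie)
  (proj₁ (level-partitions facts j)) (proj₂ (level-partitions facts j)) (inner-bounded facts j ie)

level-pairLength : ∀ {k} {s : Sym k} {n} → DurfeeFacts s n → ∀ j → pairLength (pairOf s j) ≤ n
level-pairLength {s = s} facts j = ≤-trans
  (+-mono-≤ (length≤sum (α s j) (proj₁ (isPartition-elim (α s j) (proj₁ (level-partitions facts j)))))
            (length≤sum (β s j) (proj₁ (isPartition-elim (β s j) (proj₂ (level-partitions facts j))))))
  (level-size facts j)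

strictShifted-at : ∀ {k} (s : Sym k) → isStrictShiftedSym s ≡ true → ∀ j → inner j ≡ true →
  strictShiftedPair (pairOf s j) ≡ true
strictShifted-at s e j ie =
  trans (≡-sym (if-true ie)) (allFin-at {f = λ j → if inner j then strictShiftedPair (pairOf s j) else true} e j)

strictShifted-intro : ∀ {k} (s : Sym k) → (∀ j → inner j ≡ true → strictShiftedPair (pairOf s j) ≡ true) →
  isStrictShiftedSym s ≡ true
strictShifted-intro {k} s h = all-intro (allFin k) at
  where
    at : ∀ j → (if inner j then strictShiftedPair (pairOf s j) else true) ≡ true
    at j with inner j in ie
    ... | true = h j ie
    ... | false = refl

levelRank : ∀ {k} → Fin k → Pair → ℤ
levelRank j (α , β) = if inner j then (+ length α) - (+ length β) - + 1
                      else (+ length α) - (+ length β)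

innerRank : Pair → ℤ
innerRank (α , β) = (+ length α) - (+ length β) - + 1

rank-inner : ∀ {k} (s : Sym k) j → inner j ≡ true → rank s j ≡ innerRank (pairOf s j)
rank-inner s j ie = cong (λ b → if b then innerRank (pairOf s j) else (+ length (α s j)) - (+ length (β s j))) ie

innerRank-⊖ : ∀ x y → (+ suc x) - (+ y) - + 1 ≡ x ⊖ y
innerRank-⊖ x y = begin
  (+ suc x) - (+ y) - + 1  ≡⟨ cong (λ i → i - + 1) ([+m]-[+n]≡m⊖n (suc x) y) ⟩
  suc x ⊖ y - + 1          ≡⟨ distribˡ-⊖-+-neg 0 (suc x) y ⟩
  suc x ⊖ suc (y + 0)      ≡⟨ [1+m]⊖[1+n]≡m⊖n x (y + 0) ⟩
  x ⊖ (y + 0)              ≡⟨ cong (x ⊖_) (+-identityʳ y) ⟩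
  x ⊖ y                    ∎
  where open ≡-Reasoning

⊖≡+⇒ : ∀ x y m → x ⊖ y ≡ + m → x ≡ y + m
⊖≡+⇒ x y m e with y ≤? x
... | yes y≤x = trans (≡-sym (m+[n∸m]≡n y≤x))
                      (cong (λ z → y + z) (ℤ+-injective (trans (≡-sym (⊖-≥ y≤x)) e)))
... | no y≰x with y ∸ x in eq
...   | zero = ⊥-elim (y≰x (m∸n≡0⇒m≤n eq))
...   | suc d with () ← trans (≡-sym (cong (λ z → - (+ z)) eq)) (trans (≡-sym (⊖-< (≰⇒> y≰x))) e)

+⊖≡ : ∀ y m → (y + m) ⊖ y ≡ + m
+⊖≡ y m = subst (λ z → (y + m) ⊖ z ≡ + m) (+-identityʳ y) (trans (+-cancelˡ-⊖ y m 0) (⊖-≥ z≤n))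

innerRank⇒hasRank : ∀ {p} m → Admissible p → innerRank p ≡ + m → HasRank p m
innerRank⇒hasRank m (admissible {u = u} {v} _ _ _ _ _ _ _) e =
  ⊖≡+⇒ (length u) (length v) m (trans (≡-sym (innerRank-⊖ (length u) (length v))) e)

hasRank⇒innerRank : ∀ p m → HasRank p m → innerRank p ≡ + m
hasRank⇒innerRank (a ∷ u , v) m r rewrite r = trans (innerRank-⊖ (length v + m) (length v)) (+⊖≡ (length v) m)

hasRanks-at : ∀ {k} (s : Sym k) ms → hasRanks s ms ≡ true → ∀ j → rank s j ≡ + lookup ms j
hasRanks-at s ms e j = toWitness (≡true⇒T (allFin-at {f = λ j → isYes (rank s j ≟ℤ + lookup ms j)} e j))

hasRanks-intro : ∀ {k} (s : Sym k) ms → (∀ j → rank s j ≡ + lookup ms j) → hasRanks s ms ≡ true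
hasRanks-intro {k} s ms h = all-intro (allFin k) (λ j → T⇒≡true (fromWitness (h j)))

-- Acting on all inner levels at once

Levels : ℕ → Set
Levels k = Vec (List ℕ) k

pairAt : ∀ {k} → Levels k → Levels k → Fin k → Pair
pairAt as bs j = lookup as j , lookup bs j

mapInner : ∀ {k} → (Pair → ℕ × Pair) → Levels k → Levels k → Vec ℕ (pred k) × Levels k × Levels k
mapInner {zero} F as bs = [] , [] , []
mapInner {suc zero} F as bs = [] , as , bs
mapInner {suc (suc k)} F (a ∷ as) (b ∷ bs) =
  let t , (a' , b') = F (a , b)
      ts , as' , bs' = mapInner F as bs
  in t ∷ ts , a' ∷ as' , b' ∷ bs'

unmapInner : ∀ {k} → (ℕ → Pair → Pair) → Vec ℕ (pred k) → Levels k → Levels k → Levels k × Levels k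
unmapInner {zero} G ts as bs = [] , []
unmapInner {suc zero} G ts as bs = as , bs
unmapInner {suc (suc k)} G (t ∷ ts) (a ∷ as) (b ∷ bs) =
  let a' , b' = G t (a , b)
      as' , bs' = unmapInner G ts as bs
  in a' ∷ as' , b' ∷ bs'

shiftAt : ∀ {k} → Vec ℕ (pred k) → Fin k → ℕ
shiftAt {suc zero} [] fzero = 0
shiftAt {suc (suc k)} (t ∷ ts) fzero = t
shiftAt {suc (suc k)} (t ∷ ts) (fsuc j) = shiftAt {suc k} ts j

shiftAt-last : ∀ {k} (ts : Vec ℕ (pred k)) (j : Fin k) → inner j ≡ false → shiftAt ts j ≡ 0
shiftAt-last {suc zero} [] fzero _ = refl
shiftAt-last {suc (suc k)} (t ∷ ts) (fsuc j) e = shiftAt-last {suc k} ts j e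

mapInner-pair : ∀ {k} F (as bs : Levels k) j →
  pairAt (proj₁ (proj₂ (mapInner F as bs))) (proj₂ (proj₂ (mapInner F as bs))) j
    ≡ (if inner j then proj₂ (F (pairAt as bs j)) else pairAt as bs j)
mapInner-pair F (a ∷ []) (b ∷ []) fzero = refl
mapInner-pair F (a ∷ a' ∷ as) (b ∷ b' ∷ bs) fzero = refl
mapInner-pair F (a ∷ a' ∷ as) (b ∷ b' ∷ bs) (fsuc j) = mapInner-pair F (a' ∷ as) (b' ∷ bs) j

mapInner-shift : ∀ {k} F (as bs : Levels k) j →
  shiftAt (proj₁ (mapInner F as bs)) j ≡ (if inner j then proj₁ (F (pairAt as bs j)) else 0)
mapInner-shift F (a ∷ []) (b ∷ []) fzero = refl
mapInner-shift F (a ∷ a' ∷ as) (b ∷ b' ∷ bs) fzero = refl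
mapInner-shift F (a ∷ a' ∷ as) (b ∷ b' ∷ bs) (fsuc j) = mapInner-shift F (a' ∷ as) (b' ∷ bs) j

unmapInner-pair : ∀ {k} G ts (as bs : Levels k) j →
  pairAt (proj₁ (unmapInner G ts as bs)) (proj₂ (unmapInner G ts as bs)) j
    ≡ (if inner j then G (shiftAt ts j) (pairAt as bs j) else pairAt as bs j)
unmapInner-pair {suc zero} G [] (a ∷ []) (b ∷ []) fzero = refl
unmapInner-pair {suc (suc k)} G (t ∷ ts) (a ∷ a' ∷ as) (b ∷ b' ∷ bs) fzero = refl
unmapInner-pair {suc (suc k)} G (t ∷ ts) (a ∷ a' ∷ as) (b ∷ b' ∷ bs) (fsuc j) =
  unmapInner-pair G ts (a' ∷ as) (b' ∷ bs) j

unmapInner-mapInner : ∀ {k} F G (as bs : Levels k) →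
  (∀ j → inner j ≡ true → G (proj₁ (F (pairAt as bs j))) (proj₂ (F (pairAt as bs j))) ≡ pairAt as bs j) →
  unmapInner G (proj₁ (mapInner F as bs)) (proj₁ (proj₂ (mapInner F as bs))) (proj₂ (proj₂ (mapInner F as bs)))
    ≡ (as , bs)
unmapInner-mapInner F G [] [] h = refl
unmapInner-mapInner F G (a ∷ []) (b ∷ []) h = refl
unmapInner-mapInner F G (a ∷ a' ∷ as) (b ∷ b' ∷ bs) h =
  cong₂ (λ p r → proj₁ p ∷ proj₁ r , proj₂ p ∷ proj₂ r)
    (h fzero refl) (unmapInner-mapInner F G (a' ∷ as) (b' ∷ bs) (λ j → h (fsuc j)))

mapInner-unmapInner : ∀ {k} F G ts (as bs : Levels k) →
  (∀ j → inner j ≡ true → F (G (shiftAt ts j) (pairAt as bs j)) ≡ (shiftAt ts j , pairAt as bs j)) →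
  mapInner F (proj₁ (unmapInner G ts as bs)) (proj₂ (unmapInner G ts as bs)) ≡ (ts , as , bs)
mapInner-unmapInner {zero} F G [] [] [] h = refl
mapInner-unmapInner {suc zero} F G [] (a ∷ []) (b ∷ []) h = refl
mapInner-unmapInner {suc (suc k)} F G (t ∷ ts) (a ∷ a' ∷ as) (b ∷ b' ∷ bs) h =
  cong₂ (λ x r → proj₁ x ∷ proj₁ r , proj₁ (proj₂ x) ∷ proj₁ (proj₂ r) , proj₂ (proj₂ x) ∷ proj₂ (proj₂ r))
    (h fzero refl) (mapInner-unmapInner F G ts (a' ∷ as) (b' ∷ bs) (λ j → h (fsuc j)))

lookup-addShift : ∀ {k} (ms : Vec ℕ k) ts j → lookup (addShift ms ts) j ≡ lookup ms j + 2 * shiftAt ts j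
lookup-addShift (m ∷ []) [] fzero = ≡-sym (+-identityʳ m)
lookup-addShift (m ∷ m' ∷ ms) (t ∷ ts) fzero = refl
lookup-addShift (m ∷ m' ∷ ms) (t ∷ ts) (fsuc j) = lookup-addShift (m' ∷ ms) ts j

-- The enumeration of candidates: no repetitions, every symbol of n occurs

listsOfLength-unique : ∀ j vs → Unique vs → Unique (listsOfLength j vs)
listsOfLength-unique zero vs u = All.[] ∷ []
listsOfLength-unique (suc j) vs u =
  concatMap-unique (λ v → map (v ∷_) (listsOfLength j vs)) u
    (λ v → Unique.map⁺ ∷-injectiveʳ (listsOfLength-unique j vs u)) same-head
  where
    same-head : ∀ {x y z} → z ∈ map (x ∷_) (listsOfLength j vs) → z ∈ map (y ∷_) (listsOfLength j vs) → x ≡ y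
    same-head {x} {y} z∈ z∈' with ∈-map⁻ (x ∷_) z∈ | ∈-map⁻ (y ∷_) z∈'
    ... | _ , _ , refl | _ , _ , eq = ∷-injectiveˡ eq

listsOfLength-length : ∀ j vs {z} → z ∈ listsOfLength j vs → length z ≡ j
listsOfLength-length zero vs (here refl) = refl
listsOfLength-length (suc j) vs z∈ with ∈-concatMap-elim (λ v → map (v ∷_) (listsOfLength j vs)) vs z∈
... | v , _ , z∈' with ∈-map⁻ (v ∷_) z∈'
...   | _ , w∈ , refl = cong suc (listsOfLength-length j vs w∈)

smallLists-unique : ∀ n → Unique (smallLists n)
smallLists-unique n =
  concatMap-unique (λ j → listsOfLength j (oneTo n)) (Unique.upTo⁺ (suc n))
    (λ j → listsOfLength-unique j (oneTo n) (Unique.map⁺ suc-injective (Unique.upTo⁺ n)))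
    (λ z∈ z∈' → trans (≡-sym (listsOfLength-length _ _ z∈)) (listsOfLength-length _ _ z∈'))

vecsOf-unique : ∀ {A : Set} j (xs : List A) → Unique xs → Unique (vecsOf j xs)
vecsOf-unique zero xs u = All.[] ∷ []
vecsOf-unique (suc j) xs u =
  concatMap-unique (λ x → map (x ∷_) (vecsOf j xs)) u
    (λ x → Unique.map⁺ Vec.∷-injectiveʳ (vecsOf-unique j xs u)) same-head
  where
    same-head : ∀ {x y z} → z ∈ map (x ∷_) (vecsOf j xs) → z ∈ map (y ∷_) (vecsOf j xs) → x ≡ y
    same-head {x} {y} z∈ z∈' with ∈-map⁻ (x ∷_) z∈ | ∈-map⁻ (y ∷_) z∈'
    ... | _ , _ , refl | _ , _ , eq = Vec.∷-injectiveˡ eq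

vecsOf-cons : ∀ {A : Set} {j} {x : A} {xs} {v : Vec A j} → x ∈ xs → v ∈ vecsOf j xs → (x ∷ v) ∈ vecsOf (suc j) xs
vecsOf-cons {x = x} {xs} v∈ x∈ = ∈-concatMap-intro (λ y → map (y ∷_) (vecsOf _ xs)) v∈ (∈-map⁺ (x ∷_) x∈)

vecsOf-complete : ∀ {A : Set} {j} (v : Vec A j) xs → (∀ i → lookup v i ∈ xs) → v ∈ vecsOf j xs
vecsOf-complete [] xs h = here refl
vecsOf-complete (x ∷ v) xs h = vecsOf-cons (h fzero) (vecsOf-complete v xs (h ∘ fsuc))

listsOfLength-complete : ∀ (l : List ℕ) vs → All.All (_∈ vs) l → l ∈ listsOfLength (length l) vs
listsOfLength-complete [] vs _ = here refl
listsOfLength-complete (x ∷ l) vs (x∈ All.∷ l⊆) =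
  ∈-concatMap-intro (λ v → map (v ∷_) (listsOfLength (length l) vs)) x∈
    (∈-map⁺ (x ∷_) (listsOfLength-complete l vs l⊆))

parts∈oneTo : ∀ n l → all positive l ≡ true → sum l ≤ n → All.All (_∈ oneTo n) l
parts∈oneTo n [] _ _ = All.[]
parts∈oneTo n (suc x ∷ l) pos l≤n =
  ∈-map⁺ suc (∈-upTo⁺ (≤-trans (m≤m+n (suc x) (sum l)) l≤n))
  All.∷ parts∈oneTo n l (proj₂ (∧-true pos)) (≤-trans (m≤n+m (sum l) (suc x)) l≤n)

smallLists-complete : ∀ n l → isPartition l ≡ true → sum l ≤ n → l ∈ smallLists n
smallLists-complete n l part l≤n =
  ∈-concatMap-intro (λ j → listsOfLength j (oneTo n)) (∈-upTo⁺ (s≤s (≤-trans (length≤sum l pos) l≤n)))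
    (listsOfLength-complete l (oneTo n) (parts∈oneTo n l pos l≤n))
  where pos = proj₁ (isPartition-elim l part)

module _ (k n : ℕ) where
  private
    V = vecsOf k (smallLists n)
    withAlphas : ℕ → Levels k → List (Sym k)
    withAlphas d as = map (sym d as) V
    withD : ℕ → List (Sym k)
    withD d = concatMap (withAlphas d) V

  candidates-unique : Unique (candidates k n)
  candidates-unique = concatMap-unique withD (Unique.upTo⁺ (suc n)) unique-withD same-D
    where
      uV = vecsOf-unique k (smallLists n) (smallLists-unique n)
      same-alphas : ∀ {d x y z} → z ∈ withAlphas d x → z ∈ withAlphas d y → x ≡ y
      same-alphas {d} {x} {y} z∈ z∈' with ∈-map⁻ (sym d x) z∈ | ∈-map⁻ (sym d y) z∈'
      ... | _ , _ , refl | _ , _ , eq = cong alphas eq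
      unique-withD : ∀ d → Unique (withD d)
      unique-withD d = concatMap-unique (withAlphas d) uV (λ as → Unique.map⁺ (cong betas) uV) same-alphas
      same-D : ∀ {x y z} → z ∈ withD x → z ∈ withD y → x ≡ y
      same-D {x} {y} z∈ z∈' with ∈-concatMap-elim (withAlphas x) V z∈ | ∈-concatMap-elim (withAlphas y) V z∈'
      ... | as , _ , w∈ | as' , _ , w∈' with ∈-map⁻ (sym x as) w∈ | ∈-map⁻ (sym y as') w∈'
      ...   | _ , _ , refl | _ , _ , eq = cong D eq

  -- Every Durfee symbol of n is a candidate: D ≤ n, and every α^i, β^i is a
  -- partition of at most n, so it has at most n parts, each in [1..n].
  candidates-complete : ∀ (s : Sym k) → DurfeeFacts s n → s ∈ candidates k n
  candidates-complete s facts =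
    ∈-concatMap-intro withD (∈-upTo⁺ (s≤s (durfee-size facts)))
      (∈-concatMap-intro (withAlphas (D s)) (vecsOf-complete (alphas s) _ α∈)
        (∈-map⁺ (sym (D s) (alphas s)) (vecsOf-complete (betas s) _ β∈)))
    where
      α∈ : ∀ i → lookup (alphas s) i ∈ smallLists n
      α∈ i = smallLists-complete n _ (proj₁ (level-partitions facts i)) (≤-trans (m≤m+n _ _) (level-size facts i))
      β∈ : ∀ i → lookup (betas s) i ∈ smallLists n
      β∈ i = smallLists-complete n _ (proj₂ (level-partitions facts i)) (≤-trans (m≤n+m _ _) (level-size facts i))

module _ {A : Set} (p : A → Bool) where

  filterᵇ-intro : ∀ {xs x} → x ∈ xs → p x ≡ true → x ∈ filterᵇ p xs
  filterᵇ-intro x∈ px = ∈-filter⁺ (T? ∘ p) x∈ (≡true⇒T px)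

  filterᵇ-elim : ∀ {xs x} → x ∈ filterᵇ p xs → x ∈ xs × p x ≡ true
  filterᵇ-elim {xs} x∈ with ∈-filter⁻ (T? ∘ p) {xs = xs} x∈
  ... | x∈xs , px = x∈xs , T⇒≡true px

sameContentSym-levels : ∀ {k} (s s' : Sym k) → D s ≡ D s' →
  (∀ j → inner j ≡ true → SameContent (pairOf s j) (pairOf s' j)) →
  (∀ j → inner j ≡ false → pairOf s j ≡ pairOf s' j) → SameContentSym s s'
sameContentSym-levels s s' sameD inner-same last-same = sameD , same
  where
    same : ∀ j → SameContent (pairOf s j) (pairOf s' j)
    same j with inner j in ie
    ... | true = inner-same j ie
    ... | false = subst (SameContent (pairOf s j)) (last-same j ie) sameContent-refl

inner-hasRank : ∀ {k} {s : Sym k} {n} ms → DurfeeFacts s n → hasRanks s ms ≡ true →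
  ∀ j → inner j ≡ true → HasRank (pairOf s j) (lookup ms j)
inner-hasRank {s = s} ms facts hr j ie = innerRank⇒hasRank (lookup ms j) (level-admissible facts j ie)
  (trans (≡-sym (rank-inner s j ie)) (hasRanks-at s ms hr j))

hasRanks-levels : ∀ {k} (s : Sym k) ms → (∀ j → inner j ≡ true → HasRank (pairOf s j) (lookup ms j)) →
  (∀ j → inner j ≡ false → rank s j ≡ + lookup ms j) → hasRanks s ms ≡ true
hasRanks-levels s ms inner-rank last-rank = hasRanks-intro s ms at
  where
    at : ∀ j → rank s j ≡ + lookup ms j
    at j = by-level (inner j) refl
      where
        -- split on the level kind without abstracting it inside `rank s j`
        by-level : ∀ b → inner j ≡ b → rank s j ≡ + lookup ms j
        by-level true ie = trans (rank-inner s j ie) (hasRank⇒innerRank (pairOf s j) (lookup ms j) (inner-rank j ie))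
        by-level false ie = last-rank j ie

addShift-last : ∀ {k} (ms : Vec ℕ k) ts j → inner j ≡ false → lookup (addShift ms ts) j ≡ lookup ms j
addShift-last ms ts j ie =
  trans (lookup-addShift ms ts j) (trans (cong (λ z → lookup ms j + 2 * z) (shiftAt-last ts j ie)) (+-identityʳ _))

mapInner-shifts∈ : ∀ {k} F B (as bs : Levels k) → (∀ p → proj₁ (F p) < B) →
  proj₁ (mapInner F as bs) ∈ vecsOf (pred k) (upTo B)
mapInner-shifts∈ F B [] [] h = here refl
mapInner-shifts∈ F B (a ∷ []) (b ∷ []) h = here refl
mapInner-shifts∈ F B (a ∷ a' ∷ as) (b ∷ b' ∷ bs) h =
  vecsOf-cons (∈-upTo⁺ (h (a , b))) (mapInner-shifts∈ F B (a' ∷ as) (b' ∷ bs) h)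

-- The bijection

-- For N > n: Durfee symbols of n with ranks ms correspond to pairs (ts , s')
-- with ts ∈ [0..N]^{k-1} and s' strict shifted of n with ranks ms + 2 ts.
module Bijection (k n N : ℕ) (ms : Vec ℕ k) (n<N : n < N) where

  counted : Sym k → Bool
  counted s = isDurfee s n ∧ hasRanks s ms

  countedStrict : Vec ℕ (pred k) → Sym k → Bool
  countedStrict ts s = isDurfee s n ∧ isStrictShiftedSym s ∧ hasRanks s (addShift ms ts)

  shiftVectors : List (Vec ℕ (pred k))
  shiftVectors = vecsOf (pred k) (upTo (suc N))

  strictSymbols : Vec ℕ (pred k) → List (Sym k)
  strictSymbols ts = filterᵇ (countedStrict ts) (candidates k n)

  decompose : Sym k → Vec ℕ (pred k) × Sym k
  decompose s = let ts , as , bs = mapInner (reduce (suc n)) (alphas s) (betas s) in ts , sym (D s) as bs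

  recompose : Vec ℕ (pred k) × Sym k → Sym k
  recompose (ts , s') = let as , bs = unmapInner lower^ ts (alphas s') (betas s') in sym (D s') as bs

  module Decompose (s : Sym k) (durfee : isDurfee s n ≡ true) (ranks : hasRanks s ms ≡ true) where
    facts = durfeeFacts s n durfee
    ts = proj₁ (decompose s)
    s' = proj₂ (decompose s)
    m : Fin k → ℕ
    m j = lookup ms j

    reduction : ∀ j → inner j ≡ true →
      Reduction (pairOf s j) (m j) (proj₁ (reduce (suc n) (pairOf s j))) (proj₂ (reduce (suc n) (pairOf s j)))
    reduction j ie = reduce-correct (suc n) (m j) (level-admissible facts j ie) (inner-hasRank ms facts ranks j ie)
      (≤-trans (level-pairLength facts j) (≤-trans (n≤1+n n) (≤-trans (m≤n*m (suc n) 2) (m≤n+m _ (m j)))))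

    inner-level : ∀ j → inner j ≡ true → pairOf s' j ≡ proj₂ (reduce (suc n) (pairOf s j))
    inner-level j ie = trans (mapInner-pair (reduce (suc n)) (alphas s) (betas s) j) (if-true ie)

    last-level : ∀ j → inner j ≡ false → pairOf s j ≡ pairOf s' j
    last-level j ie = ≡-sym (trans (mapInner-pair (reduce (suc n)) (alphas s) (betas s) j) (if-false ie))

    inner-rank : ∀ j → inner j ≡ true → HasRank (pairOf s' j) (lookup (addShift ms ts) j)
    inner-rank j ie = subst₂ HasRank (≡-sym (inner-level j ie))
      (≡-sym (trans (lookup-addShift ms ts j) (cong (λ t → m j + 2 * t)
        (trans (mapInner-shift (reduce (suc n)) (alphas s) (betas s) j) (if-true ie)))))
      (reduced-rank (reduction j ie))

    content : SameContentSym s s'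
    content = sameContentSym-levels s s' refl
      (λ j ie → subst (SameContent (pairOf s j)) (≡-sym (inner-level j ie)) (reduced-content (reduction j ie)))
      last-level

    durfee' : isDurfee s' n ≡ true
    durfee' = trans (≡-sym (isDurfee-sameContent s s' n content)) durfee

    strict' : isStrictShiftedSym s' ≡ true
    strict' = strictShifted-intro s' (λ j ie →
      subst (λ p → strictShiftedPair p ≡ true) (≡-sym (inner-level j ie)) (reduced-strict (reduction j ie)))

    ranks' : hasRanks s' (addShift ms ts) ≡ true
    ranks' = hasRanks-levels s' (addShift ms ts) inner-rank (λ j ie →
      trans (cong (levelRank j) (≡-sym (last-level j ie)))
            (trans (hasRanks-at s ms ranks j) (cong +_ (≡-sym (addShift-last ms ts j ie)))))

    decompose∈ : decompose s ∈ tagged shiftVectors strictSymbols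
    decompose∈ = ∈-tagged⁺
      (mapInner-shifts∈ (reduce (suc n)) (suc N) (alphas s) (betas s)
        (λ p → s≤s (≤-trans (reduce-bound (suc n) p) n<N)))
      (filterᵇ-intro (countedStrict ts) (candidates-complete k n s' (durfeeFacts s' n durfee'))
        (cong₂ _∧_ durfee' (cong₂ _∧_ strict' ranks')))

    recompose-decompose : recompose (decompose s) ≡ s
    recompose-decompose = cong (λ r → sym (D s) (proj₁ r) (proj₂ r))
      (unmapInner-mapInner (reduce (suc n)) lower^ (alphas s) (betas s) (λ j ie → reduced-lower (reduction j ie)))

  module Recompose (ts : Vec ℕ (pred k)) (s' : Sym k) (durfee : isDurfee s' n ≡ true)
                   (strict : isStrictShiftedSym s' ≡ true) (ranks : hasRanks s' (addShift ms ts) ≡ true) where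
    facts = durfeeFacts s' n durfee
    s = recompose (ts , s')
    m : Fin k → ℕ
    m j = lookup ms j
    t : Fin k → ℕ
    t j = shiftAt ts j

    shifted-rank : ∀ j → inner j ≡ true → HasRank (pairOf s' j) (m j + 2 * t j)
    shifted-rank j ie = subst (HasRank (pairOf s' j)) (lookup-addShift ms ts j)
      (inner-hasRank (addShift ms ts) facts ranks j ie)

    lowering : ∀ j → inner j ≡ true → Lowering (pairOf s' j) (m j) (lower^ (t j) (pairOf s' j))
    lowering j ie = lower^-correct (t j) (m j) (level-admissible facts j ie) (shifted-rank j ie)

    inner-level : ∀ j → inner j ≡ true → pairOf s j ≡ lower^ (t j) (pairOf s' j)
    inner-level j ie = trans (unmapInner-pair lower^ ts (alphas s') (betas s') j) (if-true ie)

    last-level : ∀ j → inner j ≡ false → pairOf s' j ≡ pairOf s j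
    last-level j ie = ≡-sym (trans (unmapInner-pair lower^ ts (alphas s') (betas s') j) (if-false ie))

    content : SameContentSym s' s
    content = sameContentSym-levels s' s refl
      (λ j ie → subst (SameContent (pairOf s' j)) (≡-sym (inner-level j ie)) (lowered-content (lowering j ie)))
      last-level

    durfee' : isDurfee s n ≡ true
    durfee' = trans (≡-sym (isDurfee-sameContent s' s n content)) durfee

    ranks' : hasRanks s ms ≡ true
    ranks' = hasRanks-levels s ms
      (λ j ie → subst (λ p → HasRank p (m j)) (≡-sym (inner-level j ie)) (lowered-rank (lowering j ie)))
      (λ j ie → trans (cong (levelRank j) (≡-sym (last-level j ie)))
                      (trans (hasRanks-at s' (addShift ms ts) ranks j) (cong +_ (addShift-last ms ts j ie))))

    recompose∈ : s ∈ filterᵇ counted (candidates k n)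
    recompose∈ = filterᵇ-intro counted (candidates-complete k n s (durfeeFacts s n durfee')) (cong₂ _∧_ durfee' ranks')

    -- 2 t_j ≤ rank < number of parts ≤ n, so n + 1 raises suffice.
    shift<fuel : ∀ j → inner j ≡ true → t j < suc n
    shift<fuel j ie = s≤s (<⇒≤ (<-≤-trans
      (≤-<-trans (≤-trans (m≤n*m (t j) 2) (m≤n+m _ (m j)))
                 (rank<pairLength (m j + 2 * t j) (level-admissible facts j ie) (shifted-rank j ie)))
      (level-pairLength facts j)))

    decompose-recompose : decompose s ≡ (ts , s')
    decompose-recompose = cong (λ r → proj₁ r , sym (D s') (proj₁ (proj₂ r)) (proj₂ (proj₂ r)))
      (mapInner-unmapInner (reduce (suc n)) lower^ ts (alphas s') (betas s') (λ j ie →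
        reduce-lower^ (t j) (suc n) (m j) (level-admissible facts j ie) (strictShifted-at s' strict j ie)
          (shifted-rank j ie) (shift<fuel j ie)))

  private
    counted-facts : ∀ {s} → s ∈ filterᵇ counted (candidates k n) → isDurfee s n ≡ true × hasRanks s ms ≡ true
    counted-facts s∈ = ∧-true (proj₂ (filterᵇ-elim counted {candidates k n} s∈))

    strict-facts : ∀ {ts s'} → (ts , s') ∈ tagged shiftVectors strictSymbols →
      isDurfee s' n ≡ true × isStrictShiftedSym s' ≡ true × hasRanks s' (addShift ms ts) ≡ true
    strict-facts {ts} mem with ∧-true (proj₂ (filterᵇ-elim (countedStrict ts) {candidates k n}
                                  (proj₂ (∈-tagged⁻ {T = shiftVectors} {L = strictSymbols} mem))))
    ... | durfee , rest = durfee , ∧-true rest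

  -- Both sides count duplicate-free lists matched by decompose and recompose;
  -- the length of the tagged list is the partial sum.
  counts : 𝒟 k ms n ≡ partialSum k ms n N
  counts = trans
    (length-bijection decompose recompose _ _
      (Unique.filter⁺ (T? ∘ counted) (candidates-unique k n))
      (tagged-unique shiftVectors strictSymbols (vecsOf-unique (pred k) (upTo (suc N)) (Unique.upTo⁺ (suc N)))
        (λ ts → Unique.filter⁺ (T? ∘ countedStrict ts) (candidates-unique k n)))
      (λ s∈ → let d , r = counted-facts s∈ in Decompose.decompose∈ _ d r)
      (λ { {ts , s'} m → let d , st , r = strict-facts m in Recompose.recompose∈ ts s' d st r })
      (λ s∈ → let d , r = counted-facts s∈ in Decompose.recompose-decompose _ d r)
      (λ { {ts , s'} m → let d , st , r = strict-facts m in Recompose.decompose-recompose ts s' d st r }))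
    (length-tagged shiftVectors strictSymbols)

corollary2p7 : (k : ℕ) → 2 ≤ k → (ms : Vec ℕ k) → (n : ℕ) →
    ∃[ N₀ ] ((N : ℕ) → N₀ ≤ N → 𝒟 k ms n ≡ partialSum k ms n N)
corollary2p7 k _ ms n = suc n , λ N n<N → Bijection.counts k n N ms n<N
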